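{- Let $h$ and $h'$ be Hessenberg functions with $h>h'$. Then $I_h\subset I_{h'}$ (i.e., $I_h$ is contained in $I_{h'}$).
   Context: A Hessenberg function is an $n$-tuple $h=(h_1,\ldots,h_n)$ of integers with $i\le h_i\le n$ for all $i$ and $h_i\le h_{i+1}$ for $1\le i\le n-1$. Hessenberg functions are partially ordered by $h\le h'$ iff $h_i\le h'_i$ for all $i$; $h>h'$ means $h\ge h'$ and $h\ne h'$. For $S\subseteq\{1,\ldots,n\}$, $e_d(S)$ denotes the sum of all squarefree monomials $x_{i_1}\cdots x_{i_d}$ with $i_1<\cdots<i_d$ in $S$ (with $e_0(S)=1$, $e_d(S)=0$ for $d<0$ or $d>|S|$), and $e_d(1,\ldots,m)$ means $S=\{1,\ldots,m\}$. $I_h$ is the ideal of $\mathbb{Z}[x_1,\ldots,x_n]$ generated by $\mathfrak{C}_h=\{e_{h_i-r}(1,\ldots,h_i): 1\le i\le n,\ 0\le r\le i-1\}$. -}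

module Defs where

open import Data.Nat as ℕ using (ℕ; zero; suc; _≤_; _<ᵇ_; _≡ᵇ_)
open import Data.Integer as ℤ using (ℤ)
open import Data.Bool using (Bool; true; false; _∧_; if_then_else_)
open import Data.Fin using (Fin; toℕ)
open import Data.Vec as Vec using (Vec; []; _∷_)
open import Data.List as List using (List; []; _∷_; _++_; map; concatMap; filter)
open import Data.List.Relation.Unary.All using (All)
open import Data.Product using (_×_; _,_; Σ; ∃; proj₁; proj₂)
open import Relation.Binary.PropositionalEquality using (_≡_)
open import Relation.Nullary using (¬_)
open import Relation.Nullary.Decidable using (T?)
open import Data.Bool using (T)

-- Polynomial ring ℤ[x₁,…,xₙ]
-- A polynomial is a finite formal sum of terms c·x^v (c ∈ ℤ, v ∈ ℕⁿ),
-- represented as a list of terms; two such lists denote the same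
-- polynomial iff all their coefficients agree.

Monomial : ℕ → Set
Monomial n = Vec ℕ n

Poly : ℕ → Set
Poly n = List (ℤ × Monomial n)

_==ᵥ_ : ∀ {n} → Monomial n → Monomial n → Bool
[] ==ᵥ [] = true
(a ∷ u) ==ᵥ (b ∷ v) = (a ≡ᵇ b) ∧ (u ==ᵥ v)

coeff : ∀ {n} → Poly n → Monomial n → ℤ
coeff [] m = ℤ.0ℤ
coeff ((c , v) ∷ p) m = (if v ==ᵥ m then c else ℤ.0ℤ) ℤ.+ coeff p m

_≈ₚ_ : ∀ {n} → Poly n → Poly n → Set
p ≈ₚ q = ∀ m → coeff p m ≡ coeff q m

infix 4 _≈ₚ_
infixl 6 _+ₚ_
infixl 7 _*ₚ_

0ₚ : ∀ {n} → Poly n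
0ₚ = []

_+ₚ_ : ∀ {n} → Poly n → Poly n → Poly n
p +ₚ q = p ++ q

_*ₚ_ : ∀ {n} → Poly n → Poly n → Poly n
p *ₚ q = concatMap (λ t → map (λ s → (proj₁ t ℤ.* proj₁ s , Vec.zipWith ℕ._+_ (proj₂ t) (proj₂ s))) q) p

squarefree : (n : ℕ) → List (Monomial n)
squarefree zero = [] ∷ []
squarefree (suc n) = map (0 ∷_) (squarefree n) ++ map (1 ∷_) (squarefree n)

deg : ∀ {n} → Monomial n → ℕ
deg = Vec.sum

supportIn : ∀ {n} → (Fin n → Bool) → Monomial n → Bool
supportIn {zero} S [] = true
supportIn {suc n} S (a ∷ v) = (if a ≡ᵇ 0 then true else S Fin.zero) ∧ supportIn (λ j → S (Fin.suc j)) v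
  where import Data.Fin as Fin

-- e_d(S) = sum of all squarefree monomials x_{i₁}⋯x_{i_d}, i₁<⋯<i_d in S
-- (e_0(S) = 1, and e_d(S) = 0 for d > |S|; negative d never arises below)
e : ∀ {n} → ℕ → (Fin n → Bool) → Poly n
e {n} d S = map (λ v → (ℤ.1ℤ , v))
  (filter (λ v → T? ((deg v ≡ᵇ d) ∧ supportIn S v)) (squarefree n))

-- the set {1,…,m} (1-based), i.e. indices j : Fin n with toℕ j < m
upto : ∀ {n} → ℕ → (Fin n → Bool)
upto m j = toℕ j <ᵇ m

_∈⟨_⟩ : ∀ {n} → Poly n → (Poly n → Set) → Set
_∈⟨_⟩ {n} f G = Σ (List (Poly n × Poly n)) λ cs →
  All (λ cg → G (proj₂ cg)) cs ×
  (f ≈ₚ List.foldr (λ cg acc → proj₁ cg *ₚ proj₂ cg +ₚ acc) 0ₚ cs)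

_⊆ᴵ_ : ∀ {n} → (Poly n → Set) → (Poly n → Set) → Set
G ⊆ᴵ G' = ∀ f → f ∈⟨ G ⟩ → f ∈⟨ G' ⟩

-- Hessenberg functions. h : Fin n → ℕ, index j : Fin n corresponds to
-- i = toℕ j + 1.

record IsHessenberg (n : ℕ) (h : Fin n → ℕ) : Set where
  field
    lower : ∀ j → suc (toℕ j) ≤ h j
    upper : ∀ j → h j ≤ n
    mono  : ∀ (j k : Fin n) → toℕ k ≡ suc (toℕ j) → h j ≤ h k

_≤ᴴ_ : ∀ {n} → (Fin n → ℕ) → (Fin n → ℕ) → Set
h ≤ᴴ h' = ∀ j → h j ≤ h' j

_>ᴴ_ : ∀ {n} → (Fin n → ℕ) → (Fin n → ℕ) → Set
h >ᴴ h' = (h' ≤ᴴ h) × ¬ (∀ j → h j ≡ h' j)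

-- the generating set 𝔠_h = { e_{h_i - r}(1,…,h_i) : 1 ≤ i ≤ n, 0 ≤ r ≤ i-1 }
-- (with i = toℕ j + 1; since r ≤ i-1 < h_i, truncated ∸ is exact)
𝔠 : ∀ {n} → (Fin n → ℕ) → Poly n → Set
𝔠 {n} h g = ∃ λ (j : Fin n) → ∃ λ (r : ℕ) → (r ≤ toℕ j) × (g ≡ e (h j ℕ.∸ r) (upto (h j)))

-- Write e_{d}[m] for the elementary symmetric polynomial of degree d in x₁,…,x_m.
-- Pascal's rule e_{d+1}[m+1] = e_{d+1}[m] + x_{m+1} e_d[m] shows, by induction on m,
-- that e_d[m] ∈ I_{h'} whenever h'_i ≤ m ≤ n and m − d ≤ i − 1: the base case m = h'_i
-- is the generator e_{h'_i − r}[h'_i] with r = h'_i − d (or is 0 when d > m), and the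
-- step replaces (m + 1, d + 1) by (m, d + 1) and (m, d), which keep the condition.
-- Every generator e_{h_i − r}[h_i] of I_h satisfies it because h'_i ≤ h_i, so only
-- h ≥ h' is needed; the degenerate d = 0 is excluded by h'_i ≥ i.
module Submission where

open import Defs
open import Algebra using (CommutativeMonoid)
open import Data.Bool using (Bool; true; false; _∧_; if_then_else_; T)
open import Data.Bool.Properties using (∧-zeroʳ; ∧-commutativeMonoid; if-eta; T-∧)
open import Data.Empty using (⊥-elim)
open import Data.Fin using (Fin; toℕ; fromℕ<) renaming (zero to fzero; suc to fsuc)
open import Data.Fin.Properties using (toℕ-fromℕ<)
open import Data.Integer using (ℤ; 0ℤ; 1ℤ) renaming (_+_ to _+ℤ_; _*_ to _*ℤ_)
import Data.Integer.Properties as ℤ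
open import Data.List as List using (List; []; _∷_; _++_; map; filter)
import Data.List.Properties as List
open import Data.List.Relation.Unary.All using (All; []; _∷_)
open import Data.List.Relation.Unary.All.Properties using (++⁺)
open import Data.Nat
  using (ℕ; zero; suc; _+_; _∸_; _≤_; _<_; z≤n; s≤s; _≤′_; ≤′-refl; ≤′-step; _<ᵇ_; _≡ᵇ_; _≤ᵇ_)
open import Data.Nat.Properties
open import Data.Product using (_×_; _,_; proj₁; proj₂)
open import Data.Unit using (tt)
open import Data.Vec as Vec using ([]; _∷_)
open import Data.Vec.Properties using (zipWith-assoc; zipWith-identityˡ)
open import Relation.Binary.PropositionalEquality
open import Relation.Nullary using (¬_)
open import Relation.Nullary.Decidable using (T?; yes; no)
open import Relation.Unary using (Decidable)
open import Function using (_∘_; Equivalence)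

open import Algebra.Properties.CommutativeSemigroup
  (CommutativeMonoid.commutativeSemigroup ∧-commutativeMonoid) using (interchange)

coeff-++ : ∀ {n} (p q : Poly n) m → coeff (p ++ q) m ≡ coeff p m +ℤ coeff q m
coeff-++ [] q m = sym (ℤ.+-identityˡ _)
coeff-++ ((c , v) ∷ p) q m = begin
  c′ +ℤ coeff (p ++ q) m          ≡⟨ cong (c′ +ℤ_) (coeff-++ p q m) ⟩
  c′ +ℤ (coeff p m +ℤ coeff q m) ≡⟨ ℤ.+-assoc c′ (coeff p m) (coeff q m) ⟨
  c′ +ℤ coeff p m +ℤ coeff q m   ∎
  where
  open ≡-Reasoning
  c′ = if v ==ᵥ m then c else 0ℤ

Term : ℕ → Set
Term n = ℤ × Monomial n

termMul : ∀ {n} → Term n → Term n → Term n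
termMul (c , v) (d , w) = (c *ℤ d , Vec.zipWith _+_ v w)

_≤ᵥ_ : ∀ {n} → Monomial n → Monomial n → Bool
[] ≤ᵥ [] = true
(a ∷ u) ≤ᵥ (b ∷ v) = (a ≤ᵇ b) ∧ (u ≤ᵥ v)

_∸ᵥ_ : ∀ {n} → Monomial n → Monomial n → Monomial n
[] ∸ᵥ [] = []
(a ∷ u) ∸ᵥ (b ∷ v) = (a ∸ b) ∷ (u ∸ᵥ v)

m<ᵇ1+n≡m≤ᵇn : ∀ m n → (m <ᵇ suc n) ≡ (m ≤ᵇ n)
m<ᵇ1+n≡m≤ᵇn zero n = refl
m<ᵇ1+n≡m≤ᵇn (suc m) n = refl

m+n≡ᵇo : ∀ m n o → (m + n ≡ᵇ o) ≡ (m ≤ᵇ o) ∧ (n ≡ᵇ o ∸ m)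
m+n≡ᵇo zero n o = refl
m+n≡ᵇo (suc m) n zero = refl
m+n≡ᵇo (suc m) n (suc o) =
  trans (m+n≡ᵇo m n o) (cong (_∧ (n ≡ᵇ o ∸ m)) (sym (m<ᵇ1+n≡m≤ᵇn m o)))

u+v==ᵥw : ∀ {n} (u v w : Monomial n) → (Vec.zipWith _+_ u v ==ᵥ w) ≡ (u ≤ᵥ w) ∧ (v ==ᵥ (w ∸ᵥ u))
u+v==ᵥw [] [] [] = refl
u+v==ᵥw (a ∷ u) (b ∷ v) (c ∷ w) =
  trans (cong₂ _∧_ (m+n≡ᵇo a b c) (u+v==ᵥw u v w))
        (interchange (a ≤ᵇ c) (b ≡ᵇ c ∸ a) (u ≤ᵥ w) (v ==ᵥ (w ∸ᵥ u)))

coeff-termMul : ∀ {n} c (v : Monomial n) p w →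
  coeff (map (termMul (c , v)) p) w ≡ (if v ≤ᵥ w then c *ℤ coeff p (w ∸ᵥ v) else 0ℤ)
coeff-termMul c v [] w with v ≤ᵥ w
... | true = sym (ℤ.*-zeroʳ c)
... | false = refl
coeff-termMul c v ((c′ , u) ∷ p) w rewrite u+v==ᵥw v u w | coeff-termMul c v p w with v ≤ᵥ w
... | false = refl
... | true with u ==ᵥ (w ∸ᵥ v)
...   | true = sym (ℤ.*-distribˡ-+ c c′ _)
...   | false = trans (ℤ.+-identityˡ _) (cong (c *ℤ_) (sym (ℤ.+-identityˡ _)))

termMul-*ₚ : ∀ {n} (t : Term n) (p q : Poly n) → map (termMul t) (p *ₚ q) ≡ map (termMul t) p *ₚ q
termMul-*ₚ t [] q = refl
termMul-*ₚ t (u ∷ p) q = trans (List.map-++ (termMul t) (map (termMul u) q) (p *ₚ q))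
  (cong₂ _++_ (trans (sym (List.map-∘ q)) (List.map-cong (termMul-assoc t u) q)) (termMul-*ₚ t p q))
  where
  termMul-assoc : ∀ {n} (t u s : Term n) → termMul t (termMul u s) ≡ termMul (termMul t u) s
  termMul-assoc (a , x) (b , y) (c , z) =
    cong₂ _,_ (sym (ℤ.*-assoc a b c)) (sym (zipWith-assoc +-assoc x y z))

combination : ∀ {n} → List (Poly n × Poly n) → Poly n
combination = List.foldr (λ cg acc → proj₁ cg *ₚ proj₂ cg +ₚ acc) 0ₚ

combination-++ : ∀ {n} (cs ds : List (Poly n × Poly n)) →
  combination (cs ++ ds) ≡ combination cs ++ combination ds
combination-++ [] ds = refl
combination-++ ((c , g) ∷ cs) ds = trans (cong (c *ₚ g ++_) (combination-++ cs ds))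
  (sym (List.++-assoc (c *ₚ g) (combination cs) (combination ds)))

module Ideal {n : ℕ} (G : Poly n → Set) where

  ∈-resp-≈ : ∀ f g → f ≈ₚ g → g ∈⟨ G ⟩ → f ∈⟨ G ⟩
  ∈-resp-≈ _ _ f≈g (cs , gens , g≈) = cs , gens , λ w → trans (f≈g w) (g≈ w)

  0∈ : 0ₚ ∈⟨ G ⟩
  0∈ = [] , [] , λ _ → refl

  +-∈ : ∀ f g → f ∈⟨ G ⟩ → g ∈⟨ G ⟩ → (f +ₚ g) ∈⟨ G ⟩
  +-∈ f g (cs , gens₁ , f≈) (ds , gens₂ , g≈) = cs ++ ds , ++⁺ gens₁ gens₂ , λ w → begin
    coeff (f ++ g) w
      ≡⟨ coeff-++ f g w ⟩
    coeff f w +ℤ coeff g w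
      ≡⟨ cong₂ _+ℤ_ (f≈ w) (g≈ w) ⟩
    coeff (combination cs) w +ℤ coeff (combination ds) w
      ≡⟨ coeff-++ (combination cs) (combination ds) w ⟨
    coeff (combination cs ++ combination ds) w
      ≡⟨ cong (λ l → coeff l w) (combination-++ cs ds) ⟨
    coeff (combination (cs ++ ds)) w ∎
    where open ≡-Reasoning

  termMul-∈ : ∀ t g → g ∈⟨ G ⟩ → map (termMul t) g ∈⟨ G ⟩
  termMul-∈ (c , v) g (cs , gens , g≈) = map scale cs , scale-gens cs gens , λ w → begin
    coeff (map (termMul (c , v)) g) w
      ≡⟨ coeff-termMul c v g w ⟩
    (if v ≤ᵥ w then c *ℤ coeff g (w ∸ᵥ v) else 0ℤ)
      ≡⟨ cong (λ z → if v ≤ᵥ w then c *ℤ z else 0ℤ) (g≈ (w ∸ᵥ v)) ⟩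
    (if v ≤ᵥ w then c *ℤ coeff (combination cs) (w ∸ᵥ v) else 0ℤ)
      ≡⟨ coeff-termMul c v (combination cs) w ⟨
    coeff (map (termMul (c , v)) (combination cs)) w
      ≡⟨ cong (λ l → coeff l w) (termMul-combination cs) ⟩
    coeff (combination (map scale cs)) w ∎
    where
    open ≡-Reasoning
    scale : Poly n × Poly n → Poly n × Poly n
    scale (a , h) = map (termMul (c , v)) a , h
    scale-gens : ∀ cs → All (λ cg → G (proj₂ cg)) cs → All (λ cg → G (proj₂ cg)) (map scale cs)
    scale-gens [] [] = []
    scale-gens (_ ∷ cs) (gen ∷ gens) = gen ∷ scale-gens cs gens
    termMul-combination : ∀ cs → map (termMul (c , v)) (combination cs) ≡ combination (map scale cs)
    termMul-combination [] = refl
    termMul-combination ((a , h) ∷ cs) = trans (List.map-++ (termMul (c , v)) (a *ₚ h) (combination cs))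
      (cong₂ _++_ (termMul-*ₚ (c , v) a h) (termMul-combination cs))

  *-∈ : ∀ p g → g ∈⟨ G ⟩ → (p *ₚ g) ∈⟨ G ⟩
  *-∈ [] g g∈ = 0∈
  *-∈ (t ∷ p) g g∈ = +-∈ (map (termMul t) g) (p *ₚ g) (termMul-∈ t g g∈) (*-∈ p g g∈)

  generator-∈ : ∀ g → G g → g ∈⟨ G ⟩
  generator-∈ g gen = (1ₚ , g) ∷ [] , gen ∷ [] , λ w → cong (λ l → coeff l w) (sym 1ₚ*g≡g)
    where
    1ₚ : Poly n
    1ₚ = (1ℤ , Vec.replicate n 0) ∷ []
    termMul-1 : ∀ (s : Term n) → termMul (1ℤ , Vec.replicate n 0) s ≡ s
    termMul-1 (c , v) = cong₂ _,_ (ℤ.*-identityˡ c) (zipWith-identityˡ +-identityˡ v)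
    1ₚ*g≡g : (map (termMul (1ℤ , Vec.replicate n 0)) g ++ []) ++ [] ≡ g
    1ₚ*g≡g = trans (List.++-identityʳ _) (trans (List.++-identityʳ _)
             (trans (List.map-cong termMul-1 g) (List.map-id g)))

  combination-∈ : ∀ {G′ : Poly n → Set} cs → All (λ cg → G′ (proj₂ cg)) cs →
    (∀ g → G′ g → g ∈⟨ G ⟩) → combination cs ∈⟨ G ⟩
  combination-∈ [] [] _ = 0∈
  combination-∈ ((c , g) ∷ cs) (gen ∷ gens) G′⊆ =
    +-∈ (c *ₚ g) (combination cs) (*-∈ c g (G′⊆ g gen)) (combination-∈ cs gens G′⊆)

⊆ᴵ-generators : ∀ {n} {G G′ : Poly n → Set} → (∀ g → G g → g ∈⟨ G′ ⟩) → G ⊆ᴵ G′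
⊆ᴵ-generators {G′ = G′} G⊆ f (cs , gens , f≈) =
  ∈-resp-≈ f (combination cs) f≈ (combination-∈ cs gens G⊆)
  where open Ideal G′

𝟙 : Bool → ℤ
𝟙 b = if b then 1ℤ else 0ℤ

𝟙-¬T : ∀ b → ¬ T b → 𝟙 b ≡ 0ℤ
𝟙-¬T false _ = refl
𝟙-¬T true ¬t = ⊥-elim (¬t tt)

isSquarefree : ∀ {n} → Monomial n → Bool
isSquarefree [] = true
isSquarefree (a ∷ w) = (a ≤ᵇ 1) ∧ isSquarefree w

monomials : ∀ {n} → List (Monomial n) → Poly n
monomials = map (1ℤ ,_)

coeff-monomials-filter-++ : ∀ {n} {P : Monomial n → Set} (P? : Decidable P) us vs w →
  coeff (monomials (filter P? (us ++ vs))) w ≡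
    coeff (monomials (filter P? us)) w +ℤ coeff (monomials (filter P? vs)) w
coeff-monomials-filter-++ P? us vs w =
  trans (cong (λ p → coeff p w)
          (trans (cong monomials (List.filter-++ P? us vs)) (List.map-++ (1ℤ ,_) (filter P? us) _)))
        (coeff-++ (monomials (filter P? us)) _ w)

coeff-filter-prefixed : ∀ {n} (P : Monomial (suc n) → Bool) b (vs : List (Monomial n)) a w →
  coeff (monomials (filter (T? ∘ P) (map (b ∷_) vs))) (a ∷ w) ≡
    (if b ≡ᵇ a then coeff (monomials (filter (T? ∘ P ∘ (b ∷_)) vs)) w else 0ℤ)
coeff-filter-prefixed P b [] a w = sym (if-eta (b ≡ᵇ a))
coeff-filter-prefixed P b (v ∷ vs) a w with P (b ∷ v) | coeff-filter-prefixed P b vs a w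
... | false | ih = ih
... | true | ih with b ≡ᵇ a
...   | true = cong ((if v ==ᵥ w then 1ℤ else 0ℤ) +ℤ_) ih
...   | false = trans (ℤ.+-identityˡ _) ih

coeff-filter-squarefree : ∀ {n} (P : Monomial n → Bool) w →
  coeff (monomials (filter (T? ∘ P) (squarefree n))) w ≡ 𝟙 (isSquarefree w ∧ P w)
coeff-filter-squarefree {zero} P [] with P []
... | true = refl
... | false = refl
coeff-filter-squarefree {suc n} P (a ∷ w) = begin
  coeff (monomials (filter (T? ∘ P) (map (0 ∷_) sq ++ map (1 ∷_) sq))) (a ∷ w)
    ≡⟨ coeff-monomials-filter-++ (T? ∘ P) (map (0 ∷_) sq) (map (1 ∷_) sq) (a ∷ w) ⟩
  coeff (monomials (filter (T? ∘ P) (map (0 ∷_) sq))) (a ∷ w) +ℤ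
  coeff (monomials (filter (T? ∘ P) (map (1 ∷_) sq))) (a ∷ w)
    ≡⟨ cong₂ _+ℤ_ (coeff-filter-prefixed P 0 sq a w) (coeff-filter-prefixed P 1 sq a w) ⟩
  (if 0 ≡ᵇ a then coeff (monomials (filter (T? ∘ P ∘ (0 ∷_)) sq)) w else 0ℤ) +ℤ
  (if 1 ≡ᵇ a then coeff (monomials (filter (T? ∘ P ∘ (1 ∷_)) sq)) w else 0ℤ)
    ≡⟨ by-first-exponent a ⟩
  𝟙 (isSquarefree (a ∷ w) ∧ P (a ∷ w)) ∎
  where
  open ≡-Reasoning
  sq = squarefree n
  by-first-exponent : ∀ a →
    (if 0 ≡ᵇ a then coeff (monomials (filter (T? ∘ P ∘ (0 ∷_)) sq)) w else 0ℤ) +ℤ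
    (if 1 ≡ᵇ a then coeff (monomials (filter (T? ∘ P ∘ (1 ∷_)) sq)) w else 0ℤ)
      ≡ 𝟙 (isSquarefree (a ∷ w) ∧ P (a ∷ w))
  by-first-exponent zero = trans (ℤ.+-identityʳ _) (coeff-filter-squarefree (P ∘ (0 ∷_)) w)
  by-first-exponent (suc zero) = trans (ℤ.+-identityˡ _) (coeff-filter-squarefree (P ∘ (1 ∷_)) w)
  by-first-exponent (suc (suc a)) = refl

isMonomialOf-e : ∀ {n} → ℕ → (Fin n → Bool) → Monomial n → Bool
isMonomialOf-e d S w = isSquarefree w ∧ ((deg w ≡ᵇ d) ∧ supportIn S w)

coeff-e : ∀ {n} d (S : Fin n → Bool) w → coeff (e d S) w ≡ 𝟙 (isMonomialOf-e d S w)
coeff-e d S = coeff-filter-squarefree (λ v → (deg v ≡ᵇ d) ∧ supportIn S v)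

unit : ∀ {n} → Fin n → Monomial n
unit {suc n} fzero = 1 ∷ Vec.replicate n 0
unit (fsuc i) = 0 ∷ unit i

X : ∀ {n} → Fin n → Poly n
X i = (1ℤ , unit i) ∷ []

-- isMonomialOf-e (d ∸ 1), except that it is false for d = 0;
-- isCofactorOf-e (suc d) reduces to isMonomialOf-e d.
isCofactorOf-e : ∀ {n} → ℕ → (Fin n → Bool) → Monomial n → Bool
isCofactorOf-e d S w = isSquarefree w ∧ ((suc (deg w) ≡ᵇ d) ∧ supportIn S w)

0ᵥ≤ᵥ : ∀ {n} (w : Monomial n) → (Vec.replicate n 0 ≤ᵥ w) ≡ true
0ᵥ≤ᵥ [] = refl
0ᵥ≤ᵥ (a ∷ w) = 0ᵥ≤ᵥ w

w∸ᵥ0ᵥ : ∀ {n} (w : Monomial n) → w ∸ᵥ Vec.replicate n 0 ≡ w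
w∸ᵥ0ᵥ [] = refl
w∸ᵥ0ᵥ (a ∷ w) = cong (a ∷_) (w∸ᵥ0ᵥ w)

pascal-coeff : ∀ {n} (i : Fin n) d w →
  𝟙 (isMonomialOf-e d (upto (suc (toℕ i))) w) ≡
    𝟙 (isMonomialOf-e d (upto (toℕ i)) w) +ℤ
    (if unit i ≤ᵥ w then 𝟙 (isCofactorOf-e d (upto (toℕ i)) (w ∸ᵥ unit i)) else 0ℤ)
pascal-coeff fzero d (zero ∷ w) = sym (ℤ.+-identityʳ _)
pascal-coeff fzero d (suc zero ∷ w)
  rewrite 0ᵥ≤ᵥ w | w∸ᵥ0ᵥ w | ∧-zeroʳ (suc (deg w) ≡ᵇ d) | ∧-zeroʳ (isSquarefree w) =
  sym (ℤ.+-identityˡ _)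
pascal-coeff fzero d (suc (suc zero) ∷ w)
  rewrite 0ᵥ≤ᵥ w | w∸ᵥ0ᵥ w | ∧-zeroʳ (suc (suc (deg w)) ≡ᵇ d) | ∧-zeroʳ (isSquarefree w) = refl
pascal-coeff fzero d (suc (suc (suc a)) ∷ w) rewrite 0ᵥ≤ᵥ w = refl
pascal-coeff (fsuc i) d (zero ∷ w) = pascal-coeff i d w
pascal-coeff (fsuc i) zero (suc zero ∷ w)
  rewrite ∧-zeroʳ (isSquarefree w) | ∧-zeroʳ (isSquarefree (w ∸ᵥ unit i)) =
  sym (cong (0ℤ +ℤ_) (if-eta (unit i ≤ᵥ w)))
pascal-coeff (fsuc i) (suc d) (suc zero ∷ w) = pascal-coeff i d w
pascal-coeff (fsuc i) d (suc (suc a) ∷ w) = sym (cong (0ℤ +ℤ_) (if-eta (unit i ≤ᵥ w)))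

pascal : ∀ {n} (i : Fin n) d →
  e (suc d) (upto (suc (toℕ i))) ≈ₚ e (suc d) (upto (toℕ i)) +ₚ X i *ₚ e d (upto (toℕ i))
pascal i d w = begin
  coeff (e (suc d) (upto (suc (toℕ i)))) w
    ≡⟨ coeff-e (suc d) _ w ⟩
  𝟙 (isMonomialOf-e (suc d) (upto (suc (toℕ i))) w)
    ≡⟨ pascal-coeff i (suc d) w ⟩
  𝟙 (isMonomialOf-e (suc d) (upto (toℕ i)) w) +ℤ
  (if unit i ≤ᵥ w then 𝟙 (isMonomialOf-e d (upto (toℕ i)) (w ∸ᵥ unit i)) else 0ℤ)
    ≡⟨ cong₂ _+ℤ_ (coeff-e (suc d) _ w) coeff-X*e ⟨
  coeff (e (suc d) (upto (toℕ i))) w +ℤ coeff (X i *ₚ e d (upto (toℕ i))) w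
    ≡⟨ coeff-++ (e (suc d) (upto (toℕ i))) _ w ⟨
  coeff (e (suc d) (upto (toℕ i)) +ₚ X i *ₚ e d (upto (toℕ i))) w ∎
  where
  open ≡-Reasoning
  E = e d (upto (toℕ i))
  coeff-X*e : coeff (X i *ₚ E) w ≡
    (if unit i ≤ᵥ w then 𝟙 (isMonomialOf-e d (upto (toℕ i)) (w ∸ᵥ unit i)) else 0ℤ)
  coeff-X*e = begin
    coeff (map (termMul (1ℤ , unit i)) E ++ []) w
      ≡⟨ cong (λ p → coeff p w) (List.++-identityʳ (map (termMul (1ℤ , unit i)) E)) ⟩
    coeff (map (termMul (1ℤ , unit i)) E) w
      ≡⟨ coeff-termMul 1ℤ (unit i) E w ⟩
    (if unit i ≤ᵥ w then 1ℤ *ℤ coeff E (w ∸ᵥ unit i) else 0ℤ)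
      ≡⟨ cong (λ z → if unit i ≤ᵥ w then z else 0ℤ)
              (trans (ℤ.*-identityˡ _) (coeff-e d _ (w ∸ᵥ unit i))) ⟩
    (if unit i ≤ᵥ w then 𝟙 (isMonomialOf-e d (upto (toℕ i)) (w ∸ᵥ unit i)) else 0ℤ) ∎

pascal-fromℕ< : ∀ {n} d m (m<n : m < n) →
  e (suc d) (upto (suc m)) ≈ₚ e (suc d) (upto m) +ₚ X (fromℕ< m<n) *ₚ e d (upto m)
pascal-fromℕ< d m m<n = subst
  (λ k → e (suc d) (upto (suc k)) ≈ₚ e (suc d) (upto k) +ₚ X (fromℕ< m<n) *ₚ e d (upto k))
  (toℕ-fromℕ< m<n) (pascal (fromℕ< m<n) d)

deg≤-squarefree-upto : ∀ {n} m (w : Monomial n) →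
  T (isSquarefree w) → T (supportIn (upto m) w) → deg w ≤ m
deg≤-squarefree-upto m [] _ _ = z≤n
deg≤-squarefree-upto zero (zero ∷ w) sq supp = deg≤-squarefree-upto zero w sq supp
deg≤-squarefree-upto (suc m) (zero ∷ w) sq supp = m≤n⇒m≤1+n (deg≤-squarefree-upto m w sq supp)
deg≤-squarefree-upto (suc m) (suc zero ∷ w) sq supp = s≤s (deg≤-squarefree-upto m w sq supp)

e-vanishes : ∀ {n} d m → m < d → e {n} d (upto m) ≈ₚ 0ₚ
e-vanishes d m m<d w = trans (coeff-e d (upto m) w) (𝟙-¬T _ not-monomial)
  where
  not-monomial : ¬ T (isMonomialOf-e d (upto m) w)
  not-monomial t with Equivalence.to T-∧ t
  ... | sq , t′ with Equivalence.to T-∧ t′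
  ...   | deg≡d , supp =
    <⇒≱ m<d (subst (_≤ m) (≡ᵇ⇒≡ (deg w) d deg≡d) (deg≤-squarefree-upto m w sq supp))

module _ {n} {h : Fin n → ℕ} (H : IsHessenberg n h) where
  open Ideal (𝔠 h)

  e-upto-∈𝔠 : ∀ j d {m} → h j ≤′ m → m ≤ n → m ∸ d ≤ toℕ j → e d (upto m) ∈⟨ 𝔠 h ⟩
  e-upto-∈𝔠 j d ≤′-refl _ hj∸d≤j with d ≤? h j
  ... | yes d≤hj = generator-∈ _
    (j , h j ∸ d , hj∸d≤j , cong (λ k → e k (upto (h j))) (sym (m∸[m∸n]≡n d≤hj)))
  ... | no d≰hj = ∈-resp-≈ (e d (upto (h j))) 0ₚ (e-vanishes d (h j) (≰⇒> d≰hj)) 0∈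
  e-upto-∈𝔠 j zero (≤′-step {m} hj≤m) _ 1+m≤j =
    ⊥-elim (<⇒≱ (IsHessenberg.lower H j) (≤-trans (≤′⇒≤ hj≤m) (≤-trans (n≤1+n m) 1+m≤j)))
  e-upto-∈𝔠 j (suc d) (≤′-step {m} hj≤m) m<n m∸d≤j =
    ∈-resp-≈ (e (suc d) (upto (suc m))) (e (suc d) (upto m) +ₚ X i *ₚ e d (upto m))
      (pascal-fromℕ< d m m<n)
      (+-∈ (e (suc d) (upto m)) (X i *ₚ e d (upto m))
        (e-upto-∈𝔠 j (suc d) hj≤m (<⇒≤ m<n) (≤-trans (∸-monoʳ-≤ m (n≤1+n d)) m∸d≤j))
        (*-∈ (X i) (e d (upto m)) (e-upto-∈𝔠 j d hj≤m (<⇒≤ m<n) m∸d≤j)))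
    where
    i = fromℕ< m<n

theorem4p8 : (n : ℕ) (h h' : Fin n → ℕ) → IsHessenberg n h → IsHessenberg n h' →
    h >ᴴ h' → 𝔠 h ⊆ᴵ 𝔠 h'
theorem4p8 n h h' H H' (h'≤h , _) = ⊆ᴵ-generators generator-∈𝔠h'
  where
  generator-∈𝔠h' : ∀ g → 𝔠 h g → g ∈⟨ 𝔠 h' ⟩
  generator-∈𝔠h' _ (j , r , r≤j , refl) =
    e-upto-∈𝔠 H' j (h j ∸ r) (≤⇒≤′ (h'≤h j)) (IsHessenberg.upper H j)
      (≤-trans (≤-reflexive (m∸[m∸n]≡n r≤hj)) r≤j)
    where
    r≤hj : r ≤ h j
    r≤hj = ≤-trans r≤j (<⇒≤ (IsHessenberg.lower H j))
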